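{- Let $q \ge 2$ and $n \ge t \ge 1$ be integers. For every integer $1 \le i \le t$, \[ V_q(n-i, t-i) \le \left( \frac{t}{(q-1)n} \right)^i V_q(n,t). \]
   Context: $V_q(m,r) = \sum_{j=0}^{r} \binom{m}{j}(q-1)^j$ for nonnegative integers $m, r$ (with $\binom{m}{j} = 0$ for $j > m$); this is the cardinality of a Hamming ball of radius $r$ in $[q]^m$. -}

module Defs where

open import Data.Nat using (ℕ; zero; suc; _+_; _*_; _∸_; _^_)
open import Data.Nat.Combinatorics using (_C_)

-- V q m r = Σ_{j=0}^{r} (m choose j) (q-1)^j  (Hamming ball volume in [q]^m)
-- Note: m C j = 0 for j > m in the stdlib.
V : ℕ → ℕ → ℕ → ℕ
V q m zero    = 1
V q m (suc r) = V q m r + (m C suc r) * (q ∸ 1) ^ suc r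

-- Absorption, (q-1)(m+1) C(m,j) (q-1)^j = (j+1) C(m+1,j+1) (q-1)^(j+1), maps the
-- terms of V_q(m,r) onto the terms of V_q(m+1,r+1) with weights j+1 ≤ r+1, so
-- (q-1)(m+1) V_q(m,r) ≤ (r+1) V_q(m+1,r+1).  Hence (q-1) n V_q(m,s) ≤ t V_q(m+1,s+1)
-- whenever n/t ≤ (m+1)/(s+1), and since n/t ≤ (n-j)/(t-j) for j < i ≤ t ≤ n this
-- step can be iterated i times from (n-i, t-i) up to (n, t).
module Submission where

open import Defs
open import Data.List using (_∷_; [])
open import Data.Nat using (ℕ; zero; suc; _+_; _*_; _∸_; _^_; _≤_; s≤s)
open import Data.Nat.Combinatorics using (_C_; nCk+nC[k+1]≡[n+1]C[k+1]; nC1≡n)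
open import Data.Nat.Properties
open import Algebra.Properties.CommutativeSemigroup *-commutativeSemigroup
  using (interchange; x∙yz≈y∙xz; xy∙z≈y∙xz)
open import Data.Nat.Tactic.RingSolver using (solve; solve-∀)
open import Relation.Binary.PropositionalEquality

[k+1]*[n+1]C[k+1]≡[n+1]*nCk : ∀ n k → suc k * (suc n C suc k) ≡ suc n * (n C k)
[k+1]*[n+1]C[k+1]≡[n+1]*nCk zero    zero    = refl
[k+1]*[n+1]C[k+1]≡[n+1]*nCk zero    (suc k) = *-zeroʳ (suc (suc k))
[k+1]*[n+1]C[k+1]≡[n+1]*nCk (suc n) zero    = begin
  1 * (suc (suc n) C 1) ≡⟨ *-identityˡ _ ⟩
  suc (suc n) C 1       ≡⟨ nC1≡n (suc (suc n)) ⟩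
  suc (suc n)           ≡⟨ *-identityʳ (suc (suc n)) ⟨
  suc (suc n) * 1       ∎
  where open ≡-Reasoning
[k+1]*[n+1]C[k+1]≡[n+1]*nCk (suc n) (suc k) = begin
  suc (suc k) * (suc (suc n) C suc (suc k))
    ≡⟨ cong (suc (suc k) *_) (nCk+nC[k+1]≡[n+1]C[k+1] (suc n) (suc k)) ⟨
  suc (suc k) * (suc n C suc k + suc n C suc (suc k))
    ≡⟨ *-distribˡ-+ (suc (suc k)) (suc n C suc k) _ ⟩
  (suc n C suc k + suc k * (suc n C suc k)) + suc (suc k) * (suc n C suc (suc k))
    ≡⟨ cong₂ (λ x y → (suc n C suc k + x) + y) ([k+1]*[n+1]C[k+1]≡[n+1]*nCk n k)
                                               ([k+1]*[n+1]C[k+1]≡[n+1]*nCk n (suc k)) ⟩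
  (suc n C suc k + suc n * (n C k)) + suc n * (n C suc k)
    ≡⟨ +-assoc (suc n C suc k) _ _ ⟩
  suc n C suc k + (suc n * (n C k) + suc n * (n C suc k))
    ≡⟨ cong (suc n C suc k +_) (*-distribˡ-+ (suc n) (n C k) (n C suc k)) ⟨
  suc n C suc k + suc n * (n C k + n C suc k)
    ≡⟨ cong (λ x → suc n C suc k + suc n * x) (nCk+nC[k+1]≡[n+1]C[k+1] n k) ⟩
  suc (suc n) * (suc n C suc k)
    ∎
  where open ≡-Reasoning

term-absorption : ∀ p m j →
                  p * suc m * ((m C j) * p ^ j) ≡ suc j * ((suc m C suc j) * p ^ suc j)
term-absorption p m j = begin
  p * suc m * ((m C j) * p ^ j)       ≡⟨ cong (_* ((m C j) * p ^ j)) (*-comm p (suc m)) ⟩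
  suc m * p * ((m C j) * p ^ j)       ≡⟨ interchange (suc m) p (m C j) (p ^ j) ⟩
  suc m * (m C j) * p ^ suc j         ≡⟨ cong (_* p ^ suc j) ([k+1]*[n+1]C[k+1]≡[n+1]*nCk m j) ⟨
  suc j * (suc m C suc j) * p ^ suc j ≡⟨ *-assoc (suc j) (suc m C suc j) (p ^ suc j) ⟩
  suc j * ((suc m C suc j) * p ^ suc j) ∎
  where open ≡-Reasoning

V-absorption : ∀ q m r → (q ∸ 1) * suc m * V q m r ≤ suc r * V q (suc m) (suc r)
V-absorption q m zero =
  ≤-trans (≤-reflexive (term-absorption (q ∸ 1) m 0)) (*-monoʳ-≤ 1 (m≤n+m _ 1))
V-absorption q m (suc r) = begin
  p * suc m * (V q m r + T)         ≡⟨ *-distribˡ-+ (p * suc m) (V q m r) T ⟩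
  p * suc m * V q m r + p * suc m * T
    ≤⟨ +-monoˡ-≤ _ (≤-trans (V-absorption q m r) (*-monoˡ-≤ W (n≤1+n (suc r)))) ⟩
  suc (suc r) * W + p * suc m * T   ≡⟨ cong (suc (suc r) * W +_) (term-absorption p m (suc r)) ⟩
  suc (suc r) * W + suc (suc r) * T′ ≡⟨ *-distribˡ-+ (suc (suc r)) W T′ ⟨
  suc (suc r) * (W + T′)            ∎
  where
  open ≤-Reasoning
  p = q ∸ 1
  T = (m C suc r) * p ^ suc r
  T′ = (suc m C suc (suc r)) * p ^ suc (suc r)
  W = V q (suc m) (suc r)

V-ratio-step : ∀ q {n t m s} → n * suc s ≤ t * suc m →
               (q ∸ 1) * n * V q m s ≤ t * V q (suc m) (suc s)
V-ratio-step q {n} {t} {m} {s} n/t≤[m+1]/[s+1] = *-cancelˡ-≤ (suc m) (begin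
  suc m * ((q ∸ 1) * n * V q m s) ≡⟨ swap (suc m) (q ∸ 1) n (V q m s) ⟩
  n * ((q ∸ 1) * suc m * V q m s) ≤⟨ *-monoʳ-≤ n (V-absorption q m s) ⟩
  n * (suc s * W)                 ≡⟨ *-assoc n (suc s) W ⟨
  n * suc s * W                   ≤⟨ *-monoˡ-≤ W n/t≤[m+1]/[s+1] ⟩
  t * suc m * W                   ≡⟨ xy∙z≈y∙xz t (suc m) W ⟩
  suc m * (t * W)                 ∎)
  where
  open ≤-Reasoning
  W = V q (suc m) (suc s)
  swap : ∀ a p b v → a * (p * b * v) ≡ b * (p * a * v)
  swap = solve-∀

[i+m+1]*[s+1]≤[i+s+1]*[m+1] : ∀ i {m s} → s ≤ m → suc (i + m) * suc s ≤ suc (i + s) * suc m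
[i+m+1]*[s+1]≤[i+s+1]*[m+1] i {m} {s} s≤m = begin
  suc (i + m) * suc s       ≡⟨ solve (i ∷ m ∷ s ∷ []) ⟩
  i * suc s + suc s * suc m ≤⟨ +-monoˡ-≤ _ (*-monoʳ-≤ i (s≤s s≤m)) ⟩
  i * suc m + suc s * suc m ≡⟨ solve (i ∷ m ∷ s ∷ []) ⟩
  suc (i + s) * suc m       ∎
  where open ≤-Reasoning

V-ratio : ∀ q i {m s n t} → i + m ≡ n → i + s ≡ t → s ≤ m →
          ((q ∸ 1) * n) ^ i * V q m s ≤ t ^ i * V q n t
V-ratio q zero    refl refl _ = ≤-refl
V-ratio q (suc i) {m} {s} refl refl s≤m = begin
  (p * n) ^ suc i * V q m s               ≡⟨ xy∙z≈y∙xz (p * n) ((p * n) ^ i) (V q m s) ⟩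
  (p * n) ^ i * (p * n * V q m s)
    ≤⟨ *-monoʳ-≤ ((p * n) ^ i) (V-ratio-step q {n} {t} ([i+m+1]*[s+1]≤[i+s+1]*[m+1] i s≤m)) ⟩
  (p * n) ^ i * (t * V q (suc m) (suc s)) ≡⟨ x∙yz≈y∙xz ((p * n) ^ i) t _ ⟩
  t * ((p * n) ^ i * V q (suc m) (suc s))
    ≤⟨ *-monoʳ-≤ t (V-ratio q i (+-suc i m) (+-suc i s) (s≤s s≤m)) ⟩
  t * (t ^ i * V q n t)                   ≡⟨ *-assoc t (t ^ i) (V q n t) ⟨
  t ^ suc i * V q n t                     ∎
  where
  open ≤-Reasoning
  p = q ∸ 1
  n = suc (i + m)
  t = suc (i + s)

lemma3p1 : (q n t i : ℕ) → 2 ≤ q → 1 ≤ t → t ≤ n → 1 ≤ i → i ≤ t →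
    ((q ∸ 1) * n) ^ i * V q (n ∸ i) (t ∸ i) ≤ t ^ i * V q n t
lemma3p1 q n t i _ _ t≤n _ i≤t =
  V-ratio q i (m+[n∸m]≡n (≤-trans i≤t t≤n)) (m+[n∸m]≡n i≤t) (∸-monoˡ-≤ i t≤n)
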